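{- Let $\mathbf M_1=(S,\mathcal I_1)$ and $\mathbf M_2=(S,\mathcal I_2)$ be matroids, let $R$ be a maximum-cardinality common independent set, and let $I$ be an inclusion-wise maximal common independent set with $|I|<|R|$. Let $e\in I$ and $f\in S\setminus I$. If $D(I)$ has the arcs $(s,f)$ and $(f,e)$, then $I\triangle\{e,f\}$ is a common independent set of $\mathbf M_1$ and $\mathbf M_2$, and every inclusion-wise maximal common independent set $J$ with $I\triangle\{e,f\}\subseteq J$ satisfies $|J|\le|I|+1$.
   Context: $D(I)=D_{\mathbf M_1,\mathbf M_2}(I)$ is the digraph with vertex set $S\cup\{s,t\}$ and arcs: $(e',f')$ for $e'\in I$, $f'\in S\setminus I$ with $I\cup\{f'\}\notin\mathcal I_1$ and $(I\cup\{f'\})\setminus\{e'\}\in\mathcal I_1$; $(f',e')$ for $e'\in I$, $f'\in S\setminus I$ with $I\cup\{f'\}\notin\mathcal I_2$ and $(I\cup\{f'\})\setminus\{e'\}\in\mathcal I_2$; $(s,f')$ for $f'\in S\setminus I$ with $I\cup\{f'\}\in\mathcal I_1$; $(f',t)$ for $f'\in S\setminus I$ with $I\cup\{f'\}\in\mathcal I_2$. -}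

module Defs where

open import Data.Nat using (ℕ; _<_)
open import Data.Fin using (Fin)
open import Data.Fin.Subset
  using (Subset; _∈_; _∉_; _⊆_; _∪_; _─_; _-_; ⁅_⁆; ∣_∣)
  renaming (⊥ to ∅)
open import Data.Product using (Σ; ∃; _×_)
open import Data.Empty renaming (⊥ to False)
open import Relation.Nullary using (¬_)
open import Relation.Unary using (Decidable)

-- A matroid on the finite ground set S = Fin n, given by its family of
-- independent sets (a finite set system, hence with decidable membership).
record Matroid (n : ℕ) : Set₁ where
  field
    Indep     : Subset n → Set
    indep?    : Decidable Indep
    indep-∅   : Indep ∅
    indep-⊆   : ∀ {A B} → A ⊆ B → Indep B → Indep A
    indep-aug : ∀ {A B} → Indep A → Indep B → ∣ A ∣ < ∣ B ∣ →
                ∃ λ x → x ∈ B × x ∉ A × Indep (A ∪ ⁅ x ⁆)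

open Matroid public

data Vertex (n : ℕ) : Set where
  s t : Vertex n
  el  : Fin n → Vertex n

module _ {n : ℕ} (M₁ M₂ : Matroid n) where

  CommonIndep : Subset n → Set
  CommonIndep A = Indep M₁ A × Indep M₂ A

  MaxCardCommonIndep : Subset n → Set
  MaxCardCommonIndep R = CommonIndep R × (∀ A → CommonIndep A → ∣ A ∣ Data.Nat.≤ ∣ R ∣)

  MaximalCommonIndep : Subset n → Set
  MaximalCommonIndep I = CommonIndep I × (∀ J → CommonIndep J → I ⊆ J → J ⊆ I)

  Arc : Subset n → Vertex n → Vertex n → Set
  Arc I (el a) (el b) =
      (a ∈ I × b ∉ I × ¬ Indep M₁ (I ∪ ⁅ b ⁆) × Indep M₁ ((I ∪ ⁅ b ⁆) - a))
    ⊎ (a ∉ I × b ∈ I × ¬ Indep M₂ (I ∪ ⁅ a ⁆) × Indep M₂ ((I ∪ ⁅ a ⁆) - b))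
    where open import Data.Sum using (_⊎_)
  Arc I s (el f') = f' ∉ I × Indep M₁ (I ∪ ⁅ f' ⁆)
  Arc I (el f') t = f' ∉ I × Indep M₂ (I ∪ ⁅ f' ⁆)
  Arc I _ _ = False

_△_ : ∀ {n} → Subset n → Subset n → Subset n
A △ B = (A ─ B) ∪ (B ─ A)

⁅_,_⁆ : ∀ {n} → Fin n → Fin n → Subset n
⁅ e , f ⁆ = ⁅ e ⁆ ∪ ⁅ f ⁆

{-# OPTIONS --safe #-}
-- Write T = I △ {e, f} = (I + f) − e.  T lies in I + f, which is M₁-independent by the arc (s, f),
-- and equals the M₂-independent set (I + f) − e of the arc (f, e).  If a common independent
-- J ⊇ T had |J| ≥ |I| + 2, augmenting I + f from J in M₁ would give x ∈ J with I + x ∈ 𝓘₁, so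
-- I + x ∉ 𝓘₂ by maximality of I.  Then T + x ⊆ J is M₂-independent and larger than I, so some
-- y ∈ (T + x) ∖ I = {f, x} has I + y ∈ 𝓘₂, contradicting I + f ∉ 𝓘₂ and I + x ∉ 𝓘₂.
module Submission where

open import Defs
open import Data.Nat using (ℕ; _<_; _≤_; _+_; suc; _≤?_)
open import Data.Nat.Properties
  using (≰⇒>; <⇒≱; ≤-<-trans; ≤-reflexive; +-comm; suc-injective; module ≤-Reasoning)
open import Data.Fin using (Fin; zero; suc)
-- Renamed since, with Defs' ⁅_,_⁆ and _,_ in scope, ⁅ x , y ⁆ would be an ambiguous parse.
open import Data.Fin.Subset using (Subset; _∈_; _∉_; _⊆_; ∣_∣; _∪_; _─_; _-_; inside; outside)
  renaming (⁅_⁆ to ｛_｝)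
open import Data.Fin.Subset.Properties
open import Data.Vec.Base using (_∷_; here; there)
open import Data.Product using (_×_; _,_; proj₁; proj₂)
open import Data.Sum using (inj₁; inj₂; [_,_]′)
open import Function using (_∘_)
open import Relation.Binary.PropositionalEquality using (_≡_; sym; cong; subst; module ≡-Reasoning)
open import Relation.Nullary using (¬_; yes; no; contradiction)

x∈p─q⇒x∉q : ∀ {n} (p q : Subset n) {x} → x ∈ p ─ q → x ∉ q
x∈p─q⇒x∉q (inside ∷ p) (outside ∷ q) here ()
x∈p─q⇒x∉q (_ ∷ p) (_ ∷ q) (there x∈p─q) (there x∈q) = x∈p─q⇒x∉q p q x∈p─q x∈q

x∈p∪⁅y⁆∧x∉p⇒x≡y : ∀ {n} {p : Subset n} {x y} → x ∈ p ∪ ｛ y ｝ → x ∉ p → x ≡ y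
x∈p∪⁅y⁆∧x∉p⇒x≡y {p = p} x∈p∪y x∉p = [ (λ x∈p → contradiction x∈p x∉p) , x∈⁅y⁆⇒x≡y _ ]′ (x∈p∪q⁻ p _ x∈p∪y)

∣p∪⁅x⁆∣≡1+∣p∣ : ∀ {n} {p : Subset n} {x} → x ∉ p → ∣ p ∪ ｛ x ｝ ∣ ≡ suc ∣ p ∣
∣p∪⁅x⁆∣≡1+∣p∣ {p = inside ∷ p} {zero} x∉p = contradiction here x∉p
∣p∪⁅x⁆∣≡1+∣p∣ {p = outside ∷ p} {zero} x∉p = cong (suc ∘ ∣_∣) (∪-identityʳ p)
∣p∪⁅x⁆∣≡1+∣p∣ {p = inside ∷ p} {suc x} x∉p = cong suc (∣p∪⁅x⁆∣≡1+∣p∣ (x∉p ∘ there))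
∣p∪⁅x⁆∣≡1+∣p∣ {p = outside ∷ p} {suc x} x∉p = ∣p∪⁅x⁆∣≡1+∣p∣ (x∉p ∘ there)

1+∣p-x∣≡∣p∣ : ∀ {n} {p : Subset n} {x} → x ∈ p → suc ∣ p - x ∣ ≡ ∣ p ∣
1+∣p-x∣≡∣p∣ {p = inside ∷ p} {zero} here = cong (suc ∘ ∣_∣) (p─⊥≡p p)
1+∣p-x∣≡∣p∣ {p = inside ∷ p} {suc x} (there x∈p) = cong suc (1+∣p-x∣≡∣p∣ x∈p)
1+∣p-x∣≡∣p∣ {p = outside ∷ p} {suc x} (there x∈p) = 1+∣p-x∣≡∣p∣ x∈p

p△⁅x,y⁆≡p∪⁅y⁆-x : ∀ {n} {p : Subset n} {x y} → x ∈ p → y ∉ p → p △ ⁅ x , y ⁆ ≡ (p ∪ ｛ y ｝) - x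
p△⁅x,y⁆≡p∪⁅y⁆-x {p = p} {x} {y} x∈p y∉p = ⊆-antisym △⊆∪- ∪-⊆△
  where
  ⁅x⁆⊆p : ｛ x ｝ ⊆ p
  ⁅x⁆⊆p z∈⁅x⁆ = subst (_∈ p) (sym (x∈⁅y⁆⇒x≡y x z∈⁅x⁆)) x∈p

  ∈⁅y⁆⇒∉p : ∀ {z} → z ∈ ｛ y ｝ → z ∉ p
  ∈⁅y⁆⇒∉p z∈⁅y⁆ = y∉p ∘ subst (_∈ p) (x∈⁅y⁆⇒x≡y y z∈⁅y⁆)

  △⊆∪- : p △ ⁅ x , y ⁆ ⊆ (p ∪ ｛ y ｝) - x
  △⊆∪- z∈ with x∈p∪q⁻ (p ─ ⁅ x , y ⁆) (⁅ x , y ⁆ ─ p) z∈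
  ... | inj₁ z∈p─xy = x∈p∧x∉q⇒x∈p─q (p⊆p∪q _ (p─q⊆p _ _ z∈p─xy))
                                    (x∈p─q⇒x∉q p _ z∈p─xy ∘ p⊆p∪q _)
  ... | inj₂ z∈xy─p = x∈p∧x∉q⇒x∈p─q
    ([ p⊆p∪q _ ∘ ⁅x⁆⊆p , q⊆p∪q p _ ]′ (x∈p∪q⁻ _ _ (p─q⊆p _ _ z∈xy─p)))
    (x∈p─q⇒x∉q _ p z∈xy─p ∘ ⁅x⁆⊆p)

  ∪-⊆△ : (p ∪ ｛ y ｝) - x ⊆ p △ ⁅ x , y ⁆
  ∪-⊆△ z∈ with x∈p∪q⁻ p ｛ y ｝ (p─q⊆p _ _ z∈)
  ... | inj₁ z∈p = p⊆p∪q _ (x∈p∧x∉q⇒x∈p─q z∈p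
          ([ x∈p─q⇒x∉q _ _ z∈ , (λ z∈⁅y⁆ → ∈⁅y⁆⇒∉p z∈⁅y⁆ z∈p) ]′ ∘ x∈p∪q⁻ _ _))
  ... | inj₂ z∈⁅y⁆ = q⊆p∪q _ _ (x∈p∧x∉q⇒x∈p─q (q⊆p∪q _ _ z∈⁅y⁆) (∈⁅y⁆⇒∉p z∈⁅y⁆))

non-augmentable⇒∣B∣≤∣A∣ : ∀ {n} (M : Matroid n) {A B} → Indep M A → Indep M B →
                          (∀ {y} → y ∈ B → y ∉ A → ¬ Indep M (A ∪ ｛ y ｝)) → ∣ B ∣ ≤ ∣ A ∣
non-augmentable⇒∣B∣≤∣A∣ M {A} {B} A-indep B-indep non-augmentable with ∣ B ∣ ≤? ∣ A ∣
... | yes ∣B∣≤∣A∣ = ∣B∣≤∣A∣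
... | no ∣B∣≰∣A∣ with indep-aug M A-indep B-indep (≰⇒> ∣B∣≰∣A∣)
...   | y , y∈B , y∉A , A+y-indep = contradiction A+y-indep (non-augmentable y∈B y∉A)

module _ {n} (M₁ M₂ : Matroid n) {I : Subset n} (I-maximal : MaximalCommonIndep M₁ M₂ I) where

  maximal⇒¬Indep₂-∪ : ∀ {x} → x ∉ I → Indep M₁ (I ∪ ｛ x ｝) → ¬ Indep M₂ (I ∪ ｛ x ｝)
  maximal⇒¬Indep₂-∪ {x} x∉I I+x-indep₁ I+x-indep₂ =
    x∉I (proj₂ I-maximal _ (I+x-indep₁ , I+x-indep₂) (p⊆p∪q _) (q⊆p∪q I _ (x∈⁅x⁆ x)))

  common-superset-bound : ∀ {f} → f ∉ I → Indep M₁ (I ∪ ｛ f ｝) → ¬ Indep M₂ (I ∪ ｛ f ｝) →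
                          ∀ {A J} → A ⊆ I ∪ ｛ f ｝ → ∣ I ∣ ≤ ∣ A ∣ →
                          CommonIndep M₁ M₂ J → A ⊆ J → ∣ J ∣ ≤ ∣ I ∣ + 1
  common-superset-bound {f} f∉I I+f-indep₁ I+f-dep₂ {A} {J} A⊆I+f ∣I∣≤∣A∣ (J-indep₁ , J-indep₂) A⊆J =
    begin
      ∣ J ∣          ≤⟨ non-augmentable⇒∣B∣≤∣A∣ M₁ I+f-indep₁ J-indep₁ I+f-non-augmentable ⟩
      ∣ I ∪ ｛ f ｝ ∣  ≡⟨ ∣p∪⁅x⁆∣≡1+∣p∣ f∉I ⟩
      suc ∣ I ∣      ≡⟨ +-comm 1 ∣ I ∣ ⟩
      ∣ I ∣ + 1      ∎
    where
    open ≤-Reasoning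

    I+f-non-augmentable : ∀ {x} → x ∈ J → x ∉ I ∪ ｛ f ｝ → ¬ Indep M₁ ((I ∪ ｛ f ｝) ∪ ｛ x ｝)
    I+f-non-augmentable {x} x∈J x∉I+f I+f+x-indep₁ =
      <⇒≱ ∣I∣<∣A+x∣ (non-augmentable⇒∣B∣≤∣A∣ M₂ (proj₂ (proj₁ I-maximal)) A+x-indep₂ I-non-augmentable)
      where
      I+x-dep₂ : ¬ Indep M₂ (I ∪ ｛ x ｝)
      I+x-dep₂ = maximal⇒¬Indep₂-∪ (x∉I+f ∘ p⊆p∪q _)
        (indep-⊆ M₁ ([ p⊆p∪q _ ∘ p⊆p∪q _ , q⊆p∪q _ _ ]′ ∘ x∈p∪q⁻ I _) I+f+x-indep₁)

      A+x⊆J : A ∪ ｛ x ｝ ⊆ J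
      A+x⊆J = [ A⊆J , (λ y∈⁅x⁆ → subst (_∈ J) (sym (x∈⁅y⁆⇒x≡y x y∈⁅x⁆)) x∈J) ]′ ∘ x∈p∪q⁻ A _

      A+x-indep₂ : Indep M₂ (A ∪ ｛ x ｝)
      A+x-indep₂ = indep-⊆ M₂ A+x⊆J J-indep₂

      ∣I∣<∣A+x∣ : ∣ I ∣ < ∣ A ∪ ｛ x ｝ ∣
      ∣I∣<∣A+x∣ = ≤-<-trans ∣I∣≤∣A∣
        (p⊂q⇒∣p∣<∣q∣ (p⊆p∪q _ , x , q⊆p∪q A _ (x∈⁅x⁆ x) , x∉I+f ∘ A⊆I+f))

      I-non-augmentable : ∀ {y} → y ∈ A ∪ ｛ x ｝ → y ∉ I → ¬ Indep M₂ (I ∪ ｛ y ｝)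
      I-non-augmentable y∈A+x y∉I with x∈p∪q⁻ A _ y∈A+x
      ... | inj₁ y∈A rewrite x∈p∪⁅y⁆∧x∉p⇒x≡y (A⊆I+f y∈A) y∉I = I+f-dep₂
      ... | inj₂ y∈⁅x⁆ rewrite x∈⁅y⁆⇒x≡y x y∈⁅x⁆ = I+x-dep₂

lemma3 : {n : ℕ} (M₁ M₂ : Matroid n) (R I : Subset n) (e f : Fin n) →
         MaxCardCommonIndep M₁ M₂ R →
         MaximalCommonIndep M₁ M₂ I →
         ∣ I ∣ < ∣ R ∣ →
         e ∈ I → f ∉ I →
         Arc M₁ M₂ I s (el f) →
         Arc M₁ M₂ I (el f) (el e) →
         CommonIndep M₁ M₂ (I △ ⁅ e , f ⁆)
         × (∀ J → MaximalCommonIndep M₁ M₂ J → I △ ⁅ e , f ⁆ ⊆ J → ∣ J ∣ ≤ ∣ I ∣ + 1)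
lemma3 M₁ M₂ _ I e f _ I-maximal _ e∈I f∉I _ (inj₁ (f∈I , _)) = contradiction f∈I f∉I
lemma3 M₁ M₂ _ I e f _ I-maximal _ e∈I f∉I (_ , I+f-indep₁) (inj₂ (_ , _ , I+f-dep₂ , I+f-e-indep₂)) =
  (indep-⊆ M₁ T⊆I+f I+f-indep₁ , subst (Indep M₂) (sym T≡I+f-e) I+f-e-indep₂) ,
  λ J (J-indep , _) T⊆J →
    common-superset-bound M₁ M₂ I-maximal f∉I I+f-indep₁ I+f-dep₂ T⊆I+f ∣I∣≤∣T∣ J-indep T⊆J
  where
  T≡I+f-e : I △ ⁅ e , f ⁆ ≡ (I ∪ ｛ f ｝) - e
  T≡I+f-e = p△⁅x,y⁆≡p∪⁅y⁆-x e∈I f∉I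

  T⊆I+f : I △ ⁅ e , f ⁆ ⊆ I ∪ ｛ f ｝
  T⊆I+f rewrite T≡I+f-e = p─q⊆p _ _

  ∣I∣≤∣T∣ : ∣ I ∣ ≤ ∣ I △ ⁅ e , f ⁆ ∣
  ∣I∣≤∣T∣ = ≤-reflexive (suc-injective (begin
    suc ∣ I ∣                    ≡⟨ sym (∣p∪⁅x⁆∣≡1+∣p∣ f∉I) ⟩
    ∣ I ∪ ｛ f ｝ ∣               ≡⟨ sym (1+∣p-x∣≡∣p∣ (p⊆p∪q _ e∈I)) ⟩
    suc ∣ (I ∪ ｛ f ｝) - e ∣     ≡⟨ cong (suc ∘ ∣_∣) (sym T≡I+f-e) ⟩
    suc ∣ I △ ⁅ e , f ⁆ ∣        ∎))
    where open ≡-Reasoning
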